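{- Let $(V,\odot)$ be a finite set $V\subseteq[0,1]$ with $0,1\in V$, equipped with an associative, commutative binary operation $\odot$ that has $1$ as neutral element and is monotone in both arguments. Let $(W,S,\leqslant)$ be a totally ordered similarity space based on $(V,\odot)$. Then for any intervals $A$ and $B$ of $W$ with $A\cap B\neq\emptyset$ and for any $c\in V$, \[ U_c(A\cap B) \;=\; U_c(A)\cap U_c(B). \]
   Context: A similarity space based on $(V,\odot)$ is a pair $(W,S)$ with $W$ a non-empty set and $S\colon W^2\to V$ such that for all $u,v,w\in W$: $S(u,v)=1$ iff $u=v$; $S(u,v)=S(v,u)$; and $S(u,w)\geq S(u,v)\odot S(v,w)$. A totally ordered similarity space is a triple $(W,S,\leqslant)$ where $(W,S)$ is a finite similarity space based on $(V,\odot)$ and $\leqslant$ is a total order on $W$ such that $u\leqslant v\leqslant w$ implies $\min(S(u,v),S(v,w))\geq S(u,w)$. An interval of $W$ is a set $[u,v]=\{w\in W: u\leqslant w\leqslant v\}$ with $u\leqslant v$. For $A\subseteq W$ and $c\in V$, $U_c(A)=\{w\in W:\ \text{there is } a\in A \text{ with } S(w,a)\geq c\}$. -}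

module Defs where

open import Level using (0ℓ)
open import Data.Nat using (ℕ; suc)
open import Data.Fin using (Fin; zero; fromℕ; _≤_)
open import Data.Product using (Σ; _×_; ∃)
open import Relation.Binary.PropositionalEquality using (_≡_)
open import Relation.Binary.Structures using (IsTotalOrder)
open import Function.Bundles using (_⇔_)

-- The value set V: a finite chain with at least the two distinct elements 0 and 1.
-- Every finite V ⊆ [0,1] with 0,1 ∈ V is order-isomorphic to Fin (2 + k) with
-- its usual order, 0 ↦ zero (the least element), 1 ↦ fromℕ (suc k) (the greatest).
Val : ℕ → Set
Val k = Fin (suc (suc k))

𝟘 : ∀ {k} → Val k
𝟘 = zero

𝟙 : ∀ {k} → Val k
𝟙 {k} = fromℕ (suc k)

record IsValOp (k : ℕ) (_⊙_ : Val k → Val k → Val k) : Set where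
  field
    assoc    : ∀ x y z → (x ⊙ y) ⊙ z ≡ x ⊙ (y ⊙ z)
    comm     : ∀ x y → x ⊙ y ≡ y ⊙ x
    identityˡ : ∀ x → 𝟙 ⊙ x ≡ x
    identityʳ : ∀ x → x ⊙ 𝟙 ≡ x
    mono     : ∀ {x x′ y y′} → x ≤ x′ → y ≤ y′ → (x ⊙ y) ≤ (x′ ⊙ y′)

record IsSimilarity (k n : ℕ) (_⊙_ : Val k → Val k → Val k)
                    (S : Fin (suc n) → Fin (suc n) → Val k) : Set where
  field
    one-iff : ∀ u v → (S u v ≡ 𝟙) ⇔ (u ≡ v)
    symm    : ∀ u v → S u v ≡ S v u
    trans⊙  : ∀ u v w → (S u v ⊙ S v w) ≤ S u w

record IsTOSimilarity (k n : ℕ) (_⊙_ : Val k → Val k → Val k)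
                      (S : Fin (suc n) → Fin (suc n) → Val k)
                      (_≼_ : Fin (suc n) → Fin (suc n) → Set) : Set where
  field
    similarity : IsSimilarity k n _⊙_ S
    totalOrder : IsTotalOrder _≡_ _≼_
    between    : ∀ {u v w} → u ≼ v → v ≼ w → (S u w ≤ S u v) × (S u w ≤ S v w)

Subset : ℕ → Set₁
Subset n = Fin (suc n) → Set

Interval : ∀ {n} (_≼_ : Fin (suc n) → Fin (suc n) → Set) → Fin (suc n) → Fin (suc n) → Subset n
Interval _≼_ u v w = (u ≼ w) × (w ≼ v)

_∩_ : ∀ {n} → Subset n → Subset n → Subset n
(A ∩ B) w = A w × B w

U : ∀ {k n} (S : Fin (suc n) → Fin (suc n) → Val k) → Val k → Subset n → Subset n
U S c A w = Σ (Fin _) (λ a → A a × (c ≤ S w a))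

_≐_ : ∀ {n} → Subset n → Subset n → Set
A ≐ B = ∀ w → A w ⇔ B w

-- A point w that is c-close to some point of an interval lying above w is, by the
-- betweenness axiom, c-close to the interval's lower endpoint; dually for points
-- below w and the upper endpoint. The larger of the lower endpoints of A and B lies
-- in A ∩ B and is c-close to every w ∈ U_c(A) ∩ U_c(B) lying below it; likewise the
-- smaller upper endpoint for w lying above it. Any remaining w lies between these two
-- points of A ∩ B, hence in A ∩ B itself, and S(w,w) = 1 ≥ c.
module Submission where

open import Defs
open import Data.Nat using (ℕ; suc)
open import Data.Fin using (Fin) renaming (_≤_ to _≤ᶠ_)
open import Data.Fin.Properties using (≤-trans; ≤-reflexive; ≤fromℕ; ≤-poset)
open import Data.Product using (∃; Σ; _×_; _,_; proj₁; proj₂)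
open import Data.Sum using (inj₁; inj₂)
open import Function.Bundles using (mk⇔; Equivalence)
open import Relation.Binary.PropositionalEquality using (refl; sym)
open import Relation.Binary.Structures using (IsTotalOrder)

U-mono : ∀ {k n} (S : Fin (suc n) → Fin (suc n) → Val k) (c : Val k) {A B : Subset n} →
         (∀ x → A x → B x) → ∀ w → U S c A w → U S c B w
U-mono S c A⊆B w (a , a∈A , c≤Swa) = a , A⊆B a a∈A , c≤Swa

module TotallyOrderedSimilarity
    {k n : ℕ} {_⊙_ : Val k → Val k → Val k} {S : Fin (suc n) → Fin (suc n) → Val k}
    {_≼_ : Fin (suc n) → Fin (suc n) → Set} (T : IsTOSimilarity k n _⊙_ S _≼_) where

  open IsTOSimilarity T
  open IsSimilarity similarity using (one-iff; symm)
  open IsTotalOrder totalOrder using (total) renaming (refl to ≼-refl; trans to ≼-trans)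
  open import Relation.Binary.Reasoning.PartialOrder (≤-poset (suc (suc k)))

  ≤-S-refl : ∀ c w → c ≤ᶠ S w w
  ≤-S-refl c w = ≤-trans (≤fromℕ c) (≤-reflexive (sym (Equivalence.from (one-iff w w) refl)))

  U-Interval-below : ∀ {c l h w} → w ≼ l → U S c (Interval _≼_ l h) w → c ≤ᶠ S w l
  U-Interval-below w≼l (a , (l≼a , _) , c≤Swa) = ≤-trans c≤Swa (proj₁ (between w≼l l≼a))

  U-Interval-above : ∀ {c l h w} → h ≼ w → U S c (Interval _≼_ l h) w → c ≤ᶠ S w h
  U-Interval-above {c} {h = h} {w} h≼w (a , (_ , a≼h) , c≤Swa) = begin
    c     ≤⟨ c≤Swa ⟩
    S w a ≡⟨ symm w a ⟩
    S a w ≤⟨ proj₂ (between a≼h h≼w) ⟩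
    S h w ≡⟨ symm h w ⟩
    S w h ∎

  module _ {c : Val k} {a₁ a₂ b₁ b₂ w : Fin (suc n)} where

    private
      A B : Subset n
      A = Interval _≼_ a₁ a₂
      B = Interval _≼_ b₁ b₂

    ∩-convex : ∀ {x y} → (A ∩ B) x → (A ∩ B) y → x ≼ w → w ≼ y → (A ∩ B) w
    ∩-convex ((a₁≼x , _) , (b₁≼x , _)) ((_ , y≼a₂) , (_ , y≼b₂)) x≼w w≼y =
      (≼-trans a₁≼x x≼w , ≼-trans w≼y y≼a₂) , (≼-trans b₁≼x x≼w , ≼-trans w≼y y≼b₂)

    ∩-lowerEnd : ∃ (A ∩ B) → U S c A w → U S c B w →
                 Σ (Fin (suc n)) λ m → (A ∩ B) m × (w ≼ m → c ≤ᶠ S w m)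
    ∩-lowerEnd (z , (a₁≼z , z≼a₂) , (b₁≼z , z≼b₂)) w∈UA w∈UB with total a₁ b₁
    ... | inj₁ a₁≼b₁ = b₁ , ((a₁≼b₁ , ≼-trans b₁≼z z≼a₂) , (≼-refl , ≼-trans b₁≼z z≼b₂))
                          , λ w≼b₁ → U-Interval-below w≼b₁ w∈UB
    ... | inj₂ b₁≼a₁ = a₁ , ((≼-refl , ≼-trans a₁≼z z≼a₂) , (b₁≼a₁ , ≼-trans a₁≼z z≼b₂))
                          , λ w≼a₁ → U-Interval-below w≼a₁ w∈UA

    ∩-upperEnd : ∃ (A ∩ B) → U S c A w → U S c B w →
                 Σ (Fin (suc n)) λ M → (A ∩ B) M × (M ≼ w → c ≤ᶠ S w M)
    ∩-upperEnd (z , (a₁≼z , z≼a₂) , (b₁≼z , z≼b₂)) w∈UA w∈UB with total a₂ b₂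
    ... | inj₁ a₂≼b₂ = a₂ , ((≼-trans a₁≼z z≼a₂ , ≼-refl) , (≼-trans b₁≼z z≼a₂ , a₂≼b₂))
                          , λ a₂≼w → U-Interval-above a₂≼w w∈UA
    ... | inj₂ b₂≼a₂ = b₂ , ((≼-trans a₁≼z z≼b₂ , b₂≼a₂) , (≼-trans b₁≼z z≼b₂ , ≼-refl))
                          , λ b₂≼w → U-Interval-above b₂≼w w∈UB

    U-Interval-∩ : ∃ (A ∩ B) → U S c A w → U S c B w → U S c (A ∩ B) w
    U-Interval-∩ A∩B≠∅ w∈UA w∈UB
      with ∩-lowerEnd A∩B≠∅ w∈UA w∈UB | ∩-upperEnd A∩B≠∅ w∈UA w∈UB
    ... | m , m∈A∩B , near-m | M , M∈A∩B , near-M with total w m | total M w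
    ...   | inj₁ w≼m | _        = m , m∈A∩B , near-m w≼m
    ...   | inj₂ _   | inj₁ M≼w = M , M∈A∩B , near-M M≼w
    ...   | inj₂ m≼w | inj₂ w≼M = w , ∩-convex m∈A∩B M∈A∩B m≼w w≼M , ≤-S-refl c w

lemma3p3 : (k n : ℕ) (_⊙_ : Val k → Val k → Val k) (S : Fin (suc n) → Fin (suc n) → Val k)
           (_≼_ : Fin (suc n) → Fin (suc n) → Set) →
           IsValOp k _⊙_ → IsTOSimilarity k n _⊙_ S _≼_ →
           ∀ a₁ a₂ b₁ b₂ → a₁ ≼ a₂ → b₁ ≼ b₂ →
           ∃ (λ w → (Interval _≼_ a₁ a₂ ∩ Interval _≼_ b₁ b₂) w) →
           ∀ (c : Val k) →
           U S c (Interval _≼_ a₁ a₂ ∩ Interval _≼_ b₁ b₂)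
             ≐ (U S c (Interval _≼_ a₁ a₂) ∩ U S c (Interval _≼_ b₁ b₂))
lemma3p3 k n _⊙_ S _≼_ _ T a₁ a₂ b₁ b₂ _ _ A∩B≠∅ c w =
  mk⇔ (λ w∈U∩ → U-mono S c (λ _ → proj₁) w w∈U∩ , U-mono S c (λ _ → proj₂) w w∈U∩)
      (λ (w∈UA , w∈UB) → U-Interval-∩ A∩B≠∅ w∈UA w∈UB)
  where open TotallyOrderedSimilarity T
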